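{- Let $G$ be a triangle-free regular graph and let $k < \Delta(G)$. Suppose every edge precoloring of $G$ with colors from $\{1,\dots,\chi'(G)\}$ whose precolored edges are at most $k$ independent edges is extendable to a proper $\chi'(G)$-edge coloring of $G$. Then every edge precoloring of $G \square K_2$ with colors from $\{1,\dots,\chi'(G)+1\}$ whose precolored edges are at most $k+1$ independent edges is extendable to a proper $(\chi'(G)+1)$-edge coloring of $G \square K_2$.
   Context: $G \square H$ denotes the cartesian product of graphs. $\chi'(G)$ is the chromatic index and $\Delta(G)$ the maximum degree. Independent edges means pairwise non-adjacent edges (a matching). An edge precoloring is a proper edge coloring of some subset of the edges; it is extendable to a proper $t$-edge coloring if there is a proper edge coloring $f$ with colors $\{1,\dots,t\}$ agreeing with it on all precolored edges. -}

module Defs where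

open import Data.Nat using (ℕ; zero; suc; _≤_; _<_; _⊔_)
open import Data.Fin using (Fin; splitAt)
open import Data.Fin.Properties using (_≟_)
open import Data.Bool using (Bool; true; false; T; _∧_)
open import Data.List using (List; length; filterᵇ; allFin; map; foldr; lookup)
open import Data.List.Relation.Unary.All using (All)
open import Data.Product using (Σ; ∃; _×_; _,_)
open import Data.Sum using (_⊎_; inj₁; inj₂)
open import Relation.Nullary using (¬_; ⌊_⌋)
open import Relation.Binary.PropositionalEquality using (_≡_; _≢_)

Graph : ℕ → Set
Graph n = Fin n → Fin n → Bool

IsSimple : ∀ {n} → Graph n → Set
IsSimple {n} G = (∀ (u v : Fin n) → G u v ≡ G v u) × (∀ (v : Fin n) → G v v ≡ false)

degree : ∀ {n} → Graph n → Fin n → ℕ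
degree {n} G v = length (filterᵇ (G v) (allFin n))

maxDegree : ∀ {n} → Graph n → ℕ
maxDegree {n} G = foldr _⊔_ 0 (map (degree G) (allFin n))

Regular : ∀ {n} → Graph n → Set
Regular {n} G = ∀ (u v : Fin n) → degree G u ≡ degree G v

TriangleFree : ∀ {n} → Graph n → Set
TriangleFree {n} G = ∀ (u v w : Fin n) → ¬ T (G u v ∧ G v w ∧ G u w)

-- Cartesian product G □ K₂ on vertex set Fin (n + n):
-- the first copy is Fin n ↑ˡ n, the second copy is n ↑ʳ Fin n.
_□K₂ : ∀ {n} → Graph n → Graph (n Data.Nat.+ n)
_□K₂ {n} G x y with splitAt n x | splitAt n y
... | inj₁ u | inj₁ v = G u v
... | inj₂ u | inj₂ v = G u v
... | inj₁ u | inj₂ v = ⌊ u ≟ v ⌋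
... | inj₂ u | inj₁ v = ⌊ u ≟ v ⌋

-- An edge colouring is a function on ordered pairs, required to be
-- symmetric on edges. Proper t-edge colouring with colours {1,…,t}.
EdgeColouring : ℕ → Set
EdgeColouring n = Fin n → Fin n → ℕ

IsProperColouring : ∀ {n} → Graph n → ℕ → EdgeColouring n → Set
IsProperColouring {n} G t c =
  (∀ (u v : Fin n) → T (G u v) → c u v ≡ c v u) ×
  (∀ (u v : Fin n) → T (G u v) → 1 ≤ c u v × c u v ≤ t) ×
  (∀ (u v w : Fin n) → T (G u v) → T (G u w) → v ≢ w → c u v ≢ c u w)

Colourable : ∀ {n} → Graph n → ℕ → Set
Colourable {n} G t = Σ (EdgeColouring n) (IsProperColouring G t)

IsChromaticIndex : ∀ {n} → Graph n → ℕ → Set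
IsChromaticIndex G χ = Colourable G χ × (∀ s → Colourable G s → χ ≤ s)

PrecolouredEdge : ℕ → Set
PrecolouredEdge n = Fin n × Fin n × ℕ

Disjoint : ∀ {n} → PrecolouredEdge n → PrecolouredEdge n → Set
Disjoint (u , v , _) (u' , v' , _) = u ≢ u' × u ≢ v' × v ≢ u' × v ≢ v'

IsIndepPrecolouring : ∀ {n} → Graph n → ℕ → ℕ → List (PrecolouredEdge n) → Set
IsIndepPrecolouring G t k P =
  All (λ { (u , v , a) → T (G u v) × 1 ≤ a × a ≤ t }) P ×
  (∀ (i j : Fin (length P)) → i ≢ j → Disjoint (lookup P i) (lookup P j)) ×
  length P ≤ k

Extendable : ∀ {n} → Graph n → ℕ → List (PrecolouredEdge n) → Set
Extendable {n} G t P =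
  Σ (EdgeColouring n) λ c → IsProperColouring G t c ×
    All (λ { (u , v , a) → c u v ≡ a }) P

{-# OPTIONS --safe #-}
-- Fix a colour c ∈ {1, …, χ + 1}. Each precoloured edge of G □ K₂ is carried by an edge of G: an
-- edge inside a copy by itself, a rung at w by an edge wx whose end x avoids all other precoloured
-- edges, which exists because G is triangle-free and k < Δ(G). The carriers that are to get colour
-- c in both copies (copy edges precoloured c, carriers of rungs not precoloured c) form a matching
-- M. In each copy, the visible carriers not coloured c form an independent precolouring of G with
-- the colours other than c; when it has at most k edges it extends to a χ-edge-colouring φ. Colour
-- the copy by φ with the colours renumbered to skip c, recolour M with c, and give the rung at w
-- the colour its M-edge lost (or c if w is unmatched); as the two extensions agree on M, this is a
-- proper (χ + 1)-edge-colouring. If both copies contain precoloured edges, c is a colour not used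
-- by the precolouring (it has at most k + 1 ≤ χ edges) and each copy drops the edges of the other;
-- otherwise c is the colour of some precoloured edge, which is then dropped, and one extension
-- serves both copies.
module Submission where

open import Defs
open import Function using (_∘_)
open import Function.Bundles using (Equivalence)
open import Data.Empty using (⊥; ⊥-elim)
open import Data.Unit using (⊤; tt)
open import Data.Bool using (Bool; true; false; T; not; _∧_)
open import Data.Bool.Properties using (T?; T-∧)
import Data.Bool.Properties as Bool
open import Data.Nat using (ℕ; zero; suc; _<_; _≤_; z≤n; s≤s; s≤s⁻¹; pred; _+_; _⊔_)
import Data.Nat.Properties as ℕ
open import Data.Fin as Fin using (Fin; toℕ; fromℕ<; splitAt; join)
import Data.Fin.Properties as Fin
open import Data.Product using (∃; _×_; _,_; proj₁; proj₂)
open import Data.Sum using (_⊎_; inj₁; inj₂; [_,_]′)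
open import Data.Maybe using (Maybe; just; nothing; _<∣>_)
open import Data.Maybe.Properties using (just-injective; ≡-dec)
open import Data.List using (List; []; _∷_; _++_; length; lookup; allFin; map; foldr; filter; filterᵇ)
import Data.List.Properties as List
open import Data.List.Relation.Unary.All as All using (All; []; _∷_)
import Data.List.Relation.Unary.All.Properties as All
open import Data.List.Relation.Unary.Any as Any using (Any; here; there)
open import Data.List.Relation.Unary.Any.Properties using (lookup-index)
import Data.List.Relation.Unary.Any.Properties as Any
open import Data.List.Relation.Unary.AllPairs using (AllPairs; []; _∷_)
import Data.List.Relation.Unary.AllPairs.Properties as AllPairs
open import Data.List.Relation.Unary.Unique.Propositional using (Unique)
import Data.List.Relation.Unary.Unique.Propositional.Properties as Unique
open import Data.List.Membership.Propositional using (_∈_; _∉_; find)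
open import Data.List.Membership.Propositional.Properties
  using (∈-lookup; ∈-filter⁺; ∈-filter⁻; ∈-map⁺; ∈-map⁻)
open import Relation.Nullary using (¬_; Dec; yes; no; ¬?; ⌊_⌋; _×-dec_; contradiction)
open import Relation.Nullary.Decidable using (decidable-stable; toWitness)
open import Relation.Binary.Definitions using (Symmetric)
open import Relation.Binary.PropositionalEquality
  using (_≡_; _≢_; refl; sym; trans; cong; cong₂; subst; ≢-sym; module ≡-Reasoning)

Apart : ∀ {A : Set} → List A → List A → Set
Apart as bs = All (λ a → All (a ≢_) bs) as

module _ {A : Set} where

  lookup⇒All : ∀ {P : A → Set} xs → (∀ i → P (lookup xs i)) → All P xs
  lookup⇒All []       P-lookup = []
  lookup⇒All (x ∷ xs) P-lookup = P-lookup Fin.zero ∷ lookup⇒All xs (P-lookup ∘ Fin.suc)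

  module _ {R : A → A → Set} where

    lookup⇒AllPairs : ∀ xs → (∀ i j → i ≢ j → R (lookup xs i) (lookup xs j)) → AllPairs R xs
    lookup⇒AllPairs []       R-lookup = []
    lookup⇒AllPairs (x ∷ xs) R-lookup =
      lookup⇒All xs (λ j → R-lookup Fin.zero (Fin.suc j) λ ())
      ∷ lookup⇒AllPairs xs (λ i j i≢j → R-lookup (Fin.suc i) (Fin.suc j) (i≢j ∘ Fin.suc-injective))

    AllPairs⇒lookup : ∀ {xs} → AllPairs R xs → Symmetric R →
                      ∀ i j → i ≢ j → R (lookup xs i) (lookup xs j)
    AllPairs⇒lookup (r ∷ rs) R-sym Fin.zero    Fin.zero    i≢j = contradiction refl i≢j
    AllPairs⇒lookup (r ∷ rs) R-sym Fin.zero    (Fin.suc j) i≢j = All.lookup r (∈-lookup j)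
    AllPairs⇒lookup (r ∷ rs) R-sym (Fin.suc i) Fin.zero    i≢j = R-sym (All.lookup r (∈-lookup i))
    AllPairs⇒lookup (r ∷ rs) R-sym (Fin.suc i) (Fin.suc j) i≢j =
      AllPairs⇒lookup rs R-sym i j (i≢j ∘ cong Fin.suc)

    AllPairs-∈ : ∀ {xs x y} → AllPairs R xs → x ∈ xs → y ∈ xs → x ≡ y ⊎ R x y ⊎ R y x
    AllPairs-∈ (r ∷ rs) (here refl) (here refl) = inj₁ refl
    AllPairs-∈ (r ∷ rs) (here refl) (there y∈) = inj₂ (inj₁ (All.lookup r y∈))
    AllPairs-∈ (r ∷ rs) (there x∈) (here refl) = inj₂ (inj₂ (All.lookup r x∈))
    AllPairs-∈ (r ∷ rs) (there x∈) (there y∈) = AllPairs-∈ rs x∈ y∈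

  AllPairs-zipAll : ∀ {Q : A → Set} {R S : A → A → Set} → (∀ {x y} → Q x → Q y → R x y → S x y) →
                    ∀ {xs} → All Q xs → AllPairs R xs → AllPairs S xs
  AllPairs-zipAll f []         []         = []
  AllPairs-zipAll f (qx ∷ qxs) (rx ∷ rxs) =
    All.zipWith (λ (qy , r) → f qx qy r) (qxs , rx) ∷ AllPairs-zipAll f qxs rxs

  lookup-injective : ∀ {xs : List A} → Unique xs → ∀ {i j} → lookup xs i ≡ lookup xs j → i ≡ j
  lookup-injective unique {i} {j} eq with i Fin.≟ j
  ... | yes i≡j = i≡j
  ... | no  i≢j = contradiction eq (AllPairs⇒lookup unique ≢-sym i j i≢j)

  unique⇒length≤ : ∀ {xs : List A} {m} → Unique xs → (f : ∀ {x} → x ∈ xs → Fin m) →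
                   (∀ {x y} (x∈ : x ∈ xs) (y∈ : y ∈ xs) → f x∈ ≡ f y∈ → x ≡ y) → length xs ≤ m
  unique⇒length≤ unique f f-injective =
    Fin.injective⇒≤ {f = f ∘ ∈-lookup} (lookup-injective unique ∘ f-injective (∈-lookup _) (∈-lookup _))

  Apart-∈ : ∀ {as bs : List A} {z} → Apart as bs → z ∈ as → z ∉ bs
  Apart-∈ as#bs z∈as z∈bs = All.lookup (All.lookup as#bs z∈as) z∈bs refl

  Apart-sym : ∀ {as bs : List A} → Apart as bs → Apart bs as
  Apart-sym as#bs = All.tabulate λ b∈ → All.tabulate λ a∈ b≡a → Apart-∈ as#bs a∈ (subst (_∈ _) b≡a b∈)

  Apart-map⁻ : ∀ {B : Set} (f : A → B) {as bs} → Apart (map f as) (map f bs) → Apart as bs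
  Apart-map⁻ f fas#fbs = All.map (All.map (_∘ cong f) ∘ All.map⁻) (All.map⁻ fas#fbs)

  Apart-++ʳ : ∀ {as bs bs′ : List A} → Apart as bs → Apart as bs′ → Apart as (bs ++ bs′)
  Apart-++ʳ as#bs as#bs′ = All.zipWith (λ (a#bs , a#bs′) → All.++⁺ a#bs a#bs′) (as#bs , as#bs′)

≢just⇒≡nothing : ∀ {X : Set} {m : Maybe X} → (∀ {y} → m ≢ just y) → m ≡ nothing
≢just⇒≡nothing {m = nothing} _       = refl
≢just⇒≡nothing {m = just y}  ≢just = contradiction refl ≢just

InPalette : ℕ → ℕ → Set
InPalette t a = 1 ≤ a × a ≤ t

paletteIndex : ∀ {t a} → InPalette t a → Fin t
paletteIndex {a = suc a} (_ , a<t) = fromℕ< a<t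

paletteIndex-injective : ∀ {t a b} (a∈ : InPalette t a) (b∈ : InPalette t b) →
                         paletteIndex a∈ ≡ paletteIndex b∈ → a ≡ b
paletteIndex-injective {a = suc a} {suc b} (_ , a<t) (_ , b<t) eq =
  cong suc (Fin.fromℕ<-injective a b a<t b<t eq)

∃-unused-colour : ∀ t (cs : List ℕ) → length cs ≤ t → ∃ λ c → InPalette (suc t) c × c ∉ cs
∃-unused-colour t cs |cs|≤t with Fin.any? {n = suc t} (λ i → ¬? (Any.any? (suc (toℕ i) ℕ.≟_) cs))
... | yes (i , i∉cs) = suc (toℕ i) , (s≤s z≤n , Fin.toℕ<n i) , i∉cs
... | no  none = contradiction (Fin.injective⇒≤ index-injective) (ℕ.<⇒≱ (s≤s |cs|≤t))
  where
  used : ∀ i → suc (toℕ i) ∈ cs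
  used i = decidable-stable (Any.any? (suc (toℕ i) ℕ.≟_) cs) (λ i∉cs → none (i , i∉cs))
  index-injective : ∀ {i j} → Any.index (used i) ≡ Any.index (used j) → i ≡ j
  index-injective {i} {j} eq = Fin.toℕ-injective (ℕ.suc-injective (begin
    suc (toℕ i)                     ≡⟨ lookup-index (used i) ⟩
    lookup cs (Any.index (used i))  ≡⟨ cong (lookup cs) eq ⟩
    lookup cs (Any.index (used j))  ≡⟨ lookup-index (used j) ⟨
    suc (toℕ j)                     ∎))
    where open ≡-Reasoning

punchIn : ℕ → ℕ → ℕ
punchIn c d with d ℕ.<? c
... | yes _ = d
... | no  _ = suc d

punchOut : ℕ → ℕ → ℕ
punchOut c a with a ℕ.<? c
... | yes _ = a
... | no  _ = pred a

punchIn-≢ : ∀ c d → punchIn c d ≢ c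
punchIn-≢ c d with d ℕ.<? c
... | yes d<c = λ d≡c → ℕ.<-irrefl d≡c d<c
... | no  d≮c = λ 1+d≡c → d≮c (ℕ.≤-reflexive 1+d≡c)

punchIn-injective : ∀ c {d d′} → punchIn c d ≡ punchIn c d′ → d ≡ d′
punchIn-injective c {d} {d′} eq with d ℕ.<? c | d′ ℕ.<? c
... | yes _   | yes _    = eq
... | yes d<c | no  d′≮c = contradiction (ℕ.<-trans (ℕ.≤-reflexive (sym eq)) d<c) d′≮c
... | no  d≮c | yes d′<c = contradiction (ℕ.<-trans (ℕ.≤-reflexive eq) d′<c) d≮c
... | no  _   | no  _    = ℕ.suc-injective eq

punchIn-palette : ∀ c {t d} → InPalette t d → InPalette (suc t) (punchIn c d)
punchIn-palette c {d = d} (1≤d , d≤t) with d ℕ.<? c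
... | yes _ = 1≤d , ℕ.m≤n⇒m≤1+n d≤t
... | no  _ = s≤s z≤n , s≤s d≤t

punchOut-palette : ∀ {t c a} → InPalette (suc t) c → InPalette (suc t) a → a ≢ c →
                   InPalette t (punchOut c a)
punchOut-palette {t} {c} {a} (1≤c , c≤1+t) (1≤a , a≤1+t) a≢c with a ℕ.<? c
... | yes a<c = 1≤a , s≤s⁻¹ (ℕ.≤-trans a<c c≤1+t)
... | no  a≮c = pred-palette (ℕ.≤-trans (s≤s 1≤c) (ℕ.≤∧≢⇒< (ℕ.≮⇒≥ a≮c) (≢-sym a≢c))) a≤1+t
  where
  pred-palette : ∀ {a} → 2 ≤ a → a ≤ suc t → InPalette t (pred a)
  pred-palette {suc (suc a)} _         a≤1+t = s≤s z≤n , s≤s⁻¹ a≤1+t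
  pred-palette {suc zero}    (s≤s ()) _

punchIn-punchOut : ∀ {c a} → a ≢ c → punchIn c (punchOut c a) ≡ a
punchIn-punchOut {c} {a} a≢c with a ℕ.<? c
punchIn-punchOut {c} {a} a≢c | yes a<c with a ℕ.<? c
... | yes _   = refl
... | no  a≮c = contradiction a<c a≮c
punchIn-punchOut {c} {suc a} a≢c | no a≮c with a ℕ.<? c
... | yes a<c = contradiction (ℕ.≤-antisym a<c (ℕ.≮⇒≥ a≮c)) a≢c
... | no  _   = refl
punchIn-punchOut {c} {zero}  a≢c | no a≮c = contradiction (ℕ.n≢0⇒n>0 (≢-sym a≢c)) a≮c

ColouredBy : ∀ {m} → EdgeColouring m → PrecolouredEdge m → Set
ColouredBy φ (u , v , a) = φ u v ≡ a

PrecolouredEdgeIn : ∀ {m} → Graph m → ℕ → PrecolouredEdge m → Set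
PrecolouredEdgeIn H t (x , y , a) = T (H x y) × InPalette t a

Disjoint-sym : ∀ {m} {e e′ : PrecolouredEdge m} → Disjoint e e′ → Disjoint e′ e
Disjoint-sym (u≢u′ , u≢v′ , v≢u′ , v≢v′) = ≢-sym u≢u′ , ≢-sym v≢u′ , ≢-sym u≢v′ , ≢-sym v≢v′

regular⇒maxDegree≤degree : ∀ {n} {G : Graph n} → Regular G → ∀ w → maxDegree G ≤ degree G w
regular⇒maxDegree≤degree {n} {G} regular w =
  foldr-⊔-lub (All.map⁺ {xs = allFin n} (All.tabulate (λ {v} _ → ℕ.≤-reflexive (regular v w))))
  where
  foldr-⊔-lub : ∀ {xs} → All (_≤ degree G w) xs → foldr _⊔_ 0 xs ≤ degree G w
  foldr-⊔-lub []         = z≤n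
  foldr-⊔-lub (x≤ ∷ xs≤) = ℕ.⊔-lub x≤ (foldr-⊔-lub xs≤)

module Neighbourhoods {n} {G : Graph n} (simple : IsSimple G) (triangleFree : TriangleFree G) where

  neighbours : Fin n → List (Fin n)
  neighbours w = filterᵇ (G w) (allFin n)

  neighbours-unique : ∀ w → Unique (neighbours w)
  neighbours-unique w = Unique.filter⁺ (T? ∘ G w) (Unique.allFin⁺ n)

  ∈-neighbours⁻ : ∀ {w x} → x ∈ neighbours w → T (G w x)
  ∈-neighbours⁻ {w} x∈ = proj₂ (∈-filter⁻ (T? ∘ G w) {xs = allFin n} x∈)

  adjacent-sym : ∀ {u v} → T (G u v) → T (G v u)
  adjacent-sym {u} {v} = subst T (proj₁ simple u v)

  adjacent⇒≢ : ∀ {u v} → T (G u v) → u ≢ v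
  adjacent⇒≢ {u} uu refl = subst T (proj₂ simple u) uu

  degree≤colours : ∀ {t φ} → IsProperColouring G t φ → ∀ w → degree G w ≤ t
  degree≤colours {t} {φ} (_ , palette , distinct) w =
    unique⇒length≤ (neighbours-unique w) colourIndex colourIndex-injective
    where
    colour∈ : ∀ {x} → x ∈ neighbours w → InPalette t (φ w x)
    colour∈ x∈ = palette w _ (∈-neighbours⁻ x∈)
    colourIndex : ∀ {x} → x ∈ neighbours w → Fin t
    colourIndex = paletteIndex ∘ colour∈
    colourIndex-injective : ∀ {x y} (x∈ : x ∈ neighbours w) (y∈ : y ∈ neighbours w) →
                            colourIndex x∈ ≡ colourIndex y∈ → x ≡ y
    colourIndex-injective {x} {y} x∈ y∈ eq with x Fin.≟ y
    ... | yes x≡y = x≡y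
    ... | no  x≢y = contradiction (paletteIndex-injective (colour∈ x∈) (colour∈ y∈) eq)
                      (distinct w x y (∈-neighbours⁻ x∈) (∈-neighbours⁻ y∈) x≢y)

  Clique : List (Fin n) → Set
  Clique B = ∀ {a b} → a ∈ B → b ∈ B → a ≢ b → T (G a b)

  edge-clique : ∀ {u v} → T (G u v) → Clique (u ∷ v ∷ [])
  edge-clique uv (here refl)         (here refl)         a≢b = contradiction refl a≢b
  edge-clique uv (here refl)         (there (here refl)) _   = uv
  edge-clique uv (there (here refl)) (here refl)         _   = adjacent-sym uv
  edge-clique uv (there (here refl)) (there (here refl)) a≢b = contradiction refl a≢b

  vertex-clique : ∀ {w} → Clique (w ∷ [])
  vertex-clique (here refl) (here refl) a≢b = contradiction refl a≢b

  -- A clique holds at most one neighbour of w, as two would close a triangle with w.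
  ∃-neighbour-avoiding : ∀ w (Bs : List (List (Fin n))) → All Clique Bs → length Bs < degree G w →
                         ∃ λ x → T (G w x) × All (All (x ≢_)) Bs
  ∃-neighbour-avoiding w Bs cliques |Bs|<deg
    with Any.any? (λ x → ¬? (Any.any? (Any.any? (x Fin.≟_)) Bs)) (neighbours w)
  ... | yes free = let x , x∈ , x∉Bs = find free in
                   x , ∈-neighbours⁻ x∈ , All.map (All.¬Any⇒All¬ _) (All.¬Any⇒All¬ Bs x∉Bs)
  ... | no  none = contradiction (unique⇒length≤ (neighbours-unique w) block block-injective)
                                 (ℕ.<⇒≱ |Bs|<deg)
    where
    blocked : ∀ {x} → x ∈ neighbours w → Any (x ∈_) Bs
    blocked {x} x∈ = decidable-stable (Any.any? (Any.any? (x Fin.≟_)) Bs)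
                                      (λ x∉Bs → none (Any.map (λ { refl → x∉Bs }) x∈))
    block : ∀ {x} → x ∈ neighbours w → Fin (length Bs)
    block = Any.index ∘ blocked
    block-injective : ∀ {x y} (x∈ : x ∈ neighbours w) (y∈ : y ∈ neighbours w) →
                      block x∈ ≡ block y∈ → x ≡ y
    block-injective {x} {y} x∈ y∈ eq with x Fin.≟ y
    ... | yes x≡y = x≡y
    ... | no  x≢y = contradiction triangle (triangleFree w x y)
      where
      xy : T (G x y)
      xy = All.lookup cliques (∈-lookup (block x∈)) (lookup-index (blocked x∈))
             (subst (λ i → y ∈ lookup Bs i) (sym eq) (lookup-index (blocked y∈))) x≢y
      triangle : T (G w x ∧ G x y ∧ G w y)
      triangle = Equivalence.from T-∧ (∈-neighbours⁻ x∈ , Equivalence.from T-∧ (xy , ∈-neighbours⁻ y∈))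

-- Stacking two colourings of G into one of G □ K₂

prismAdjacent : ∀ {n} → Graph n → Fin n ⊎ Fin n → Fin n ⊎ Fin n → Bool
prismAdjacent G (inj₁ u) (inj₁ v) = G u v
prismAdjacent G (inj₂ u) (inj₂ v) = G u v
prismAdjacent G (inj₁ u) (inj₂ v) = ⌊ u Fin.≟ v ⌋
prismAdjacent G (inj₂ u) (inj₁ v) = ⌊ u Fin.≟ v ⌋

□K₂-splitAt : ∀ {n} (G : Graph n) x y → (G □K₂) x y ≡ prismAdjacent G (splitAt n x) (splitAt n y)
□K₂-splitAt {n} G x y with splitAt n x | splitAt n y
... | inj₁ _ | inj₁ _ = refl
... | inj₁ _ | inj₂ _ = refl
... | inj₂ _ | inj₁ _ = refl
... | inj₂ _ | inj₂ _ = refl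

splitAt-injective : ∀ m {n} {x y : Fin (m + n)} → splitAt m x ≡ splitAt m y → x ≡ y
splitAt-injective m {n} {x} {y} eq = begin
  x                        ≡⟨ Fin.join-splitAt m n x ⟨
  join m n (splitAt m x)   ≡⟨ cong (join m n) eq ⟩
  join m n (splitAt m y)   ≡⟨ Fin.join-splitAt m n y ⟩
  y                        ∎
  where open ≡-Reasoning

module StackColourings {n} (G : Graph n) (t c : ℕ) (c∈ : InPalette (suc t) c)
                        (φ : Bool → EdgeColouring n) (φ-proper : ∀ b → IsProperColouring G t (φ b))
                        (τ : Fin n → Maybe (Fin n))
                        (τ-adjacent : ∀ {w x} → τ w ≡ just x → T (G w x))
                        (τ-involutive : ∀ {w x} → τ w ≡ just x → τ x ≡ just w)
                        (τ-agree : ∀ {w x} → τ w ≡ just x → φ true w x ≡ φ false w x) where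

  matched? : ∀ u v → Dec (τ u ≡ just v)
  matched? u v = ≡-dec Fin._≟_ (τ u) (just v)

  recolour : EdgeColouring n → EdgeColouring n
  recolour ψ u v with matched? u v
  ... | yes _ = c
  ... | no  _ = punchIn c (ψ u v)

  recolour-matched : ∀ ψ {u v} → τ u ≡ just v → recolour ψ u v ≡ c
  recolour-matched ψ {u} {v} τu≡v with matched? u v
  ... | yes _ = refl
  ... | no  ¬τu≡v = contradiction τu≡v ¬τu≡v

  recolour-unmatched : ∀ ψ {u v} → τ u ≢ just v → recolour ψ u v ≡ punchIn c (ψ u v)
  recolour-unmatched ψ {u} {v} ¬τu≡v with matched? u v
  ... | yes τu≡v = contradiction τu≡v ¬τu≡v
  ... | no  _ = refl

  recolour-proper : ∀ {ψ} → IsProperColouring G t ψ → IsProperColouring G (suc t) (recolour ψ)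
  recolour-proper {ψ} (ψ-sym , ψ-palette , ψ-distinct) = symmetric , palette , distinct
    where
    symmetric : ∀ u v → T (G u v) → recolour ψ u v ≡ recolour ψ v u
    symmetric u v uv with matched? u v | matched? v u
    ... | yes _ | yes _ = refl
    ... | yes τu≡v | no ¬τv≡u = contradiction (τ-involutive τu≡v) ¬τv≡u
    ... | no ¬τu≡v | yes τv≡u = contradiction (τ-involutive τv≡u) ¬τu≡v
    ... | no _ | no _ = cong (punchIn c) (ψ-sym u v uv)
    palette : ∀ u v → T (G u v) → InPalette (suc t) (recolour ψ u v)
    palette u v uv with matched? u v
    ... | yes _ = c∈
    ... | no  _ = punchIn-palette c (ψ-palette u v uv)
    distinct : ∀ u v w → T (G u v) → T (G u w) → v ≢ w → recolour ψ u v ≢ recolour ψ u w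
    distinct u v w uv uw v≢w with matched? u v | matched? u w
    ... | yes τu≡v | yes τu≡w = contradiction (just-injective (trans (sym τu≡v) τu≡w)) v≢w
    ... | yes _ | no _ = ≢-sym (punchIn-≢ c (ψ u w))
    ... | no _ | yes _ = punchIn-≢ c (ψ u v)
    ... | no _ | no _ = ψ-distinct u v w uv uw v≢w ∘ punchIn-injective c

  -- The rung at w takes the colour that the τ-edge at w lost in both copies.
  rungColour : Fin n → ℕ
  rungColour w with τ w
  ... | nothing = c
  ... | just x  = punchIn c (φ true w x)

  rungColour-unmatched : ∀ {w} → τ w ≡ nothing → rungColour w ≡ c
  rungColour-unmatched eq rewrite eq = refl

  rungColour-matched : ∀ {w x} → τ w ≡ just x → rungColour w ≡ punchIn c (φ true w x)
  rungColour-matched eq rewrite eq = refl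

  rungColour-palette : ∀ w → InPalette (suc t) (rungColour w)
  rungColour-palette w with τ w in eq
  ... | nothing = c∈
  ... | just x  = punchIn-palette c (proj₁ (proj₂ (φ-proper true)) w x (τ-adjacent eq))

  rungColour-≢ : ∀ b {u v} → T (G u v) → rungColour u ≢ recolour (φ b) u v
  rungColour-≢ b {u} {v} uv with matched? u v
  ... | yes τu≡v rewrite rungColour-matched τu≡v = punchIn-≢ c (φ true u v)
  ... | no ¬τu≡v with τ u in eq
  ...   | nothing = ≢-sym (punchIn-≢ c (φ b u v))
  ...   | just x  = λ same → proj₂ (proj₂ (φ-proper b)) u x v (τ-adjacent eq) uv x≢v
                              (trans (agree b eq) (punchIn-injective c same))
    where
    x≢v : x ≢ v
    x≢v refl = ¬τu≡v refl
    agree : ∀ b {w x} → τ w ≡ just x → φ b w x ≡ φ true w x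
    agree true  _  = refl
    agree false eq = sym (τ-agree eq)

  prismColour : Fin n ⊎ Fin n → Fin n ⊎ Fin n → ℕ
  prismColour (inj₁ u) (inj₁ v) = recolour (φ true) u v
  prismColour (inj₂ u) (inj₂ v) = recolour (φ false) u v
  prismColour (inj₁ u) (inj₂ _) = rungColour u
  prismColour (inj₂ u) (inj₁ _) = rungColour u

  stacked : EdgeColouring (n + n)
  stacked x y = prismColour (splitAt n x) (splitAt n y)

  stacked-proper : IsProperColouring (G □K₂) (suc t) stacked
  stacked-proper = (λ x y xy → symmetric (splitAt n x) (splitAt n y) (splitAt-adjacent xy))
                 , (λ x y xy → palette (splitAt n x) (splitAt n y) (splitAt-adjacent xy))
                 , (λ x y z xy xz y≢z → distinct (splitAt n x) (splitAt n y) (splitAt n z)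
                                          (splitAt-adjacent xy) (splitAt-adjacent xz) (y≢z ∘ splitAt-injective n))
    where
    splitAt-adjacent : ∀ {x y} → T ((G □K₂) x y) → T (prismAdjacent G (splitAt n x) (splitAt n y))
    splitAt-adjacent {x} {y} = subst T (□K₂-splitAt G x y)

    copy-proper : ∀ b → IsProperColouring G (suc t) (recolour (φ b))
    copy-proper b = recolour-proper (φ-proper b)

    symmetric : ∀ p q → T (prismAdjacent G p q) → prismColour p q ≡ prismColour q p
    symmetric (inj₁ u) (inj₁ v) = proj₁ (copy-proper true) u v
    symmetric (inj₂ u) (inj₂ v) = proj₁ (copy-proper false) u v
    symmetric (inj₁ u) (inj₂ v) = cong rungColour ∘ toWitness
    symmetric (inj₂ u) (inj₁ v) = cong rungColour ∘ toWitness

    palette : ∀ p q → T (prismAdjacent G p q) → InPalette (suc t) (prismColour p q)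
    palette (inj₁ u) (inj₁ v) = proj₁ (proj₂ (copy-proper true)) u v
    palette (inj₂ u) (inj₂ v) = proj₁ (proj₂ (copy-proper false)) u v
    palette (inj₁ u) (inj₂ v) _ = rungColour-palette u
    palette (inj₂ u) (inj₁ v) _ = rungColour-palette u

    distinct : ∀ p q r → T (prismAdjacent G p q) → T (prismAdjacent G p r) → q ≢ r →
               prismColour p q ≢ prismColour p r
    distinct (inj₁ u) (inj₁ v) (inj₁ w) uv uw v≢w =
      proj₂ (proj₂ (copy-proper true)) u v w uv uw (v≢w ∘ cong inj₁)
    distinct (inj₂ u) (inj₂ v) (inj₂ w) uv uw v≢w =
      proj₂ (proj₂ (copy-proper false)) u v w uv uw (v≢w ∘ cong inj₂)
    distinct (inj₁ u) (inj₁ v) (inj₂ _) uv _ _ = ≢-sym (rungColour-≢ true uv)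
    distinct (inj₂ u) (inj₂ v) (inj₁ _) uv _ _ = ≢-sym (rungColour-≢ false uv)
    distinct (inj₁ u) (inj₂ _) (inj₁ w) _ uw _ = rungColour-≢ true uw
    distinct (inj₂ u) (inj₁ _) (inj₂ w) _ uw _ = rungColour-≢ false uw
    distinct (inj₁ u) (inj₂ v) (inj₂ w) uv uw v≢w =
      contradiction (cong inj₂ (trans (sym (toWitness uv)) (toWitness uw))) v≢w
    distinct (inj₂ u) (inj₁ v) (inj₁ w) uv uw v≢w =
      contradiction (cong inj₁ (trans (sym (toWitness uv)) (toWitness uw))) v≢w

-- Precoloured edges of G □ K₂ seen in G

data Kind : Set where
  copy : Bool → Kind
  rung : Kind

OppositeKinds : Kind → Kind → Set
OppositeKinds (copy b) (copy b′) = b ≢ b′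
OppositeKinds _        _         = ⊥

InLayer : Bool → Kind → Set
InLayer b (copy b′) = b ≡ b′
InLayer b rung      = ⊤

inLayer? : ∀ b k → Dec (InLayer b k)
inLayer? b (copy b′) = b Bool.≟ b′
inLayer? b rung      = yes tt

inLayer⇒¬opposite : ∀ {b k k′} → InLayer b k → InLayer b k′ → ¬ OppositeKinds k k′
inLayer⇒¬opposite {k = copy _} {copy _} refl refl b≢b = b≢b refl

InCopy : Bool → Kind → Set
InCopy b (copy b′) = b′ ≡ b
InCopy b rung      = ⊥

inCopy? : ∀ b k → Dec (InCopy b k)
inCopy? b (copy b′) = b′ Bool.≟ b
inCopy? b rung      = no λ ()

opposite⇒inCopy : ∀ b {k k′} → OppositeKinds k k′ → InCopy b k ⊎ InCopy b k′
opposite⇒inCopy b {copy b₁} {copy b₂} b₁≢b₂ with b₁ Bool.≟ b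
... | yes b₁≡b = inj₁ b₁≡b
... | no  b₁≢b =
  inj₂ (trans (Bool.¬-not (≢-sym b₁≢b₂)) (trans (cong not (Bool.¬-not b₁≢b)) (Bool.not-involutive b)))

inCopy⇒¬inLayer : ∀ {b k} → InCopy (not b) k → ¬ InLayer b k
inCopy⇒¬inLayer {b} {copy _} refl b≡not-b = Bool.not-¬ refl b≡not-b

¬inCopy⇒inLayer : ∀ {b b′ k} → ¬ InCopy (not b) k → InLayer b′ k → InLayer b k
¬inCopy⇒inLayer {k = rung}     _          _    = tt
¬inCopy⇒inLayer {b} {k = copy _} not-other refl = sym (trans (Bool.¬-not not-other) (Bool.not-involutive b))

module PrismPrecolourings {n} {G : Graph n} (simple : IsSimple G) (triangleFree : TriangleFree G) where

  open Neighbourhoods simple triangleFree public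

  data Entry : Set where
    edgeIn : Bool → Fin n → Fin n → ℕ → Entry
    rungAt : Fin n → ℕ → Entry

  -- Copy `true` is the first copy (splitAt gives inj₁), copy `false` the second.
  entryOf : Fin n ⊎ Fin n → Fin n ⊎ Fin n → ℕ → Entry
  entryOf (inj₁ u) (inj₁ v) a = edgeIn true u v a
  entryOf (inj₂ u) (inj₂ v) a = edgeIn false u v a
  entryOf (inj₁ u) (inj₂ _) a = rungAt u a
  entryOf (inj₂ u) (inj₁ _) a = rungAt u a

  entry : PrecolouredEdge (n + n) → Entry
  entry (x , y , a) = entryOf (splitAt n x) (splitAt n y) a

  entryKind : Entry → Kind
  entryKind (edgeIn b _ _ _) = copy b
  entryKind (rungAt _ _)     = rung

  entryColour : Entry → ℕ
  entryColour (edgeIn _ _ _ a) = a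
  entryColour (rungAt _ d)     = d

  entryAnchor : Entry → Fin n
  entryAnchor (edgeIn _ u _ _) = u
  entryAnchor (rungAt w _)     = w

  entryVertices : Entry → List (Fin n)
  entryVertices (edgeIn _ u v _) = u ∷ v ∷ []
  entryVertices (rungAt w _)     = w ∷ []

  ValidEntry : ℕ → Entry → Set
  ValidEntry p (edgeIn _ u v a) = T (G u v) × InPalette p a
  ValidEntry p (rungAt _ d)     = InPalette p d

  entry-valid : ∀ {p} e → PrecolouredEdgeIn (G □K₂) p e → ValidEntry p (entry e)
  entry-valid {p} (x , y , a) (xy , a∈) = valid (splitAt n x) (splitAt n y) (subst T (□K₂-splitAt G x y) xy)
    where
    valid : ∀ r s → T (prismAdjacent G r s) → ValidEntry p (entryOf r s a)
    valid (inj₁ u) (inj₁ v) uv = uv , a∈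
    valid (inj₂ u) (inj₂ v) uv = uv , a∈
    valid (inj₁ u) (inj₂ v) _  = a∈
    valid (inj₂ u) (inj₁ v) _  = a∈

  entryVertices-clique : ∀ {p} e → ValidEntry p e → Clique (entryVertices e)
  entryVertices-clique (edgeIn _ _ _ _) (uv , _) = edge-clique uv
  entryVertices-clique (rungAt _ _)     _        = vertex-clique

  prismVertices : Entry → List (Fin n ⊎ Fin n)
  prismVertices (edgeIn true  u v _) = inj₁ u ∷ inj₁ v ∷ []
  prismVertices (edgeIn false u v _) = inj₂ u ∷ inj₂ v ∷ []
  prismVertices (rungAt w _)         = inj₁ w ∷ inj₂ w ∷ []

  disjoint⇒prismVertices-apart : ∀ {p} e e′ → PrecolouredEdgeIn (G □K₂) p e →
                                 PrecolouredEdgeIn (G □K₂) p e′ → Disjoint e e′ →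
                                 Apart (prismVertices (entry e)) (prismVertices (entry e′))
  disjoint⇒prismVertices-apart (x , y , a) (x′ , y′ , a′) (xy , _) (x′y′ , _)
                               (x≢x′ , x≢y′ , y≢x′ , y≢y′) =
    All.map (λ r-end → All.map (λ r′-end → ≢-ends r-end r′-end) (endpoints x′y′)) (endpoints xy)
    where
    endpoints : ∀ {x y a} → T ((G □K₂) x y) →
                All (λ r → r ≡ splitAt n x ⊎ r ≡ splitAt n y) (prismVertices (entry (x , y , a)))
    endpoints {x} {y} {a} xy = ends (splitAt n x) (splitAt n y) (subst T (□K₂-splitAt G x y) xy)
      where
      ends : ∀ r s → T (prismAdjacent G r s) →
             All (λ q → q ≡ r ⊎ q ≡ s) (prismVertices (entryOf r s a))
      ends (inj₁ u) (inj₁ v) _  = inj₁ refl ∷ inj₂ refl ∷ []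
      ends (inj₂ u) (inj₂ v) _  = inj₁ refl ∷ inj₂ refl ∷ []
      ends (inj₁ u) (inj₂ v) uv = inj₁ refl ∷ inj₂ (cong inj₂ (toWitness uv)) ∷ []
      ends (inj₂ u) (inj₁ v) uv = inj₂ (cong inj₁ (toWitness uv)) ∷ inj₁ refl ∷ []
    ≢-ends : ∀ {r r′} → r ≡ splitAt n x ⊎ r ≡ splitAt n y → r′ ≡ splitAt n x′ ⊎ r′ ≡ splitAt n y′ →
             r ≢ r′
    ≢-ends (inj₁ refl) (inj₁ refl) = x≢x′ ∘ splitAt-injective n
    ≢-ends (inj₁ refl) (inj₂ refl) = x≢y′ ∘ splitAt-injective n
    ≢-ends (inj₂ refl) (inj₁ refl) = y≢x′ ∘ splitAt-injective n
    ≢-ends (inj₂ refl) (inj₂ refl) = y≢y′ ∘ splitAt-injective n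

  prismApart⇒apart⊎opposite : ∀ e e′ → Apart (prismVertices e) (prismVertices e′) →
                         Apart (entryVertices e) (entryVertices e′) ⊎ OppositeKinds (entryKind e) (entryKind e′)
  prismApart⇒apart⊎opposite (edgeIn true  _ _ _) (edgeIn true  _ _ _) apart = inj₁ (Apart-map⁻ inj₁ apart)
  prismApart⇒apart⊎opposite (edgeIn false _ _ _) (edgeIn false _ _ _) apart = inj₁ (Apart-map⁻ inj₂ apart)
  prismApart⇒apart⊎opposite (edgeIn true  _ _ _) (edgeIn false _ _ _) _ = inj₂ λ ()
  prismApart⇒apart⊎opposite (edgeIn false _ _ _) (edgeIn true  _ _ _) _ = inj₂ λ ()
  prismApart⇒apart⊎opposite (edgeIn true  _ _ _) (rungAt _ _) ((p ∷ _ ∷ []) ∷ (r ∷ _ ∷ []) ∷ []) =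
    inj₁ (((p ∘ cong inj₁) ∷ []) ∷ ((r ∘ cong inj₁) ∷ []) ∷ [])
  prismApart⇒apart⊎opposite (edgeIn false _ _ _) (rungAt _ _) ((_ ∷ p ∷ []) ∷ (_ ∷ r ∷ []) ∷ []) =
    inj₁ (((p ∘ cong inj₂) ∷ []) ∷ ((r ∘ cong inj₂) ∷ []) ∷ [])
  prismApart⇒apart⊎opposite (rungAt _ _) (edgeIn true  _ _ _) ((p ∷ q ∷ []) ∷ _ ∷ []) =
    inj₁ (((p ∘ cong inj₁) ∷ (q ∘ cong inj₁) ∷ []) ∷ [])
  prismApart⇒apart⊎opposite (rungAt _ _) (edgeIn false _ _ _) (_ ∷ (p ∷ q ∷ []) ∷ []) =
    inj₁ (((p ∘ cong inj₂) ∷ (q ∘ cong inj₂) ∷ []) ∷ [])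
  prismApart⇒apart⊎opposite (rungAt _ _) (rungAt _ _) ((p ∷ _ ∷ []) ∷ _ ∷ []) =
    inj₁ (((p ∘ cong inj₁) ∷ []) ∷ [])

  -- A copy edge is carried by itself, a rung at w by an edge wx to a chosen partner x.
  data Carrier : Set where
    carrier : Kind → Fin n → Fin n → ℕ → Carrier

  erase : Carrier → Entry
  erase (carrier (copy b) u v a) = edgeIn b u v a
  erase (carrier rung     w _ d) = rungAt w d

  attach : Entry → Fin n → Carrier
  attach (edgeIn b u v a) _ = carrier (copy b) u v a
  attach (rungAt w d)     x = carrier rung w x d

  erase-attach : ∀ e {x} → erase (attach e x) ≡ e
  erase-attach (edgeIn _ _ _ _) = refl
  erase-attach (rungAt _ _)     = refl

  length-erase : ∀ {A L} → map erase A ≡ L → length A ≡ length L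
  length-erase {A} refl = sym (List.length-map erase A)

  vertices : Carrier → List (Fin n)
  vertices (carrier _ u v _) = u ∷ v ∷ []

  partners : Carrier → List (Fin n)
  partners (carrier (copy _) _ _ _) = []
  partners (carrier rung     _ x _) = x ∷ []

  ValidCarrier : ℕ → Carrier → Set
  ValidCarrier p (carrier _ u v a) = T (G u v) × InPalette p a

  vertices-clique : ∀ {p} s → ValidCarrier p s → Clique (vertices s)
  vertices-clique (carrier _ _ _ _) (uv , _) = edge-clique uv

  Endpoints : Fin n → Fin n → Fin n → Fin n → Set
  Endpoints u v w y = (w ≡ u × y ≡ v) ⊎ (w ≡ v × y ≡ u)

  OnEdge : Carrier → Fin n → Fin n → Set
  OnEdge (carrier _ u v _) = Endpoints u v

  OnEdge-sym : ∀ s {w y} → OnEdge s w y → OnEdge s y w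
  OnEdge-sym (carrier _ _ _ _) (inj₁ (w≡u , y≡v)) = inj₂ (y≡v , w≡u)
  OnEdge-sym (carrier _ _ _ _) (inj₂ (w≡v , y≡u)) = inj₁ (y≡u , w≡v)

  OnEdge⇒∈ : ∀ s {w y} → OnEdge s w y → w ∈ vertices s
  OnEdge⇒∈ (carrier _ _ _ _) (inj₁ (refl , _)) = here refl
  OnEdge⇒∈ (carrier _ _ _ _) (inj₂ (refl , _)) = there (here refl)

  OnEdge-adjacent : ∀ {p} s {w y} → ValidCarrier p s → OnEdge s w y → T (G w y)
  OnEdge-adjacent (carrier _ _ _ _) (uv , _) (inj₁ (refl , refl)) = uv
  OnEdge-adjacent (carrier _ _ _ _) (uv , _) (inj₂ (refl , refl)) = adjacent-sym uv

  otherEnd : Fin n → Fin n → Fin n → Maybe (Fin n)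
  otherEnd u v w with w Fin.≟ u | w Fin.≟ v
  ... | yes _ | _     = just v
  ... | no  _ | yes _ = just u
  ... | no  _ | no  _ = nothing

  otherEnd-sound : ∀ {u v w y} → otherEnd u v w ≡ just y → Endpoints u v w y
  otherEnd-sound {u} {v} {w} eq with w Fin.≟ u | w Fin.≟ v
  otherEnd-sound refl | yes w≡u | _       = inj₁ (w≡u , refl)
  otherEnd-sound refl | no  _   | yes w≡v = inj₂ (w≡v , refl)
  otherEnd-sound ()   | no  _   | no  _

  otherEnd-complete : ∀ {u v w y} → u ≢ v → Endpoints u v w y → otherEnd u v w ≡ just y
  otherEnd-complete {u} {v} u≢v (inj₁ (refl , refl)) with u Fin.≟ u
  ... | yes _   = refl
  ... | no  u≢u = contradiction refl u≢u
  otherEnd-complete {u} {v} u≢v (inj₂ (refl , refl)) with v Fin.≟ u | v Fin.≟ v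
  ... | yes v≡u | _       = contradiction (sym v≡u) u≢v
  ... | no  _   | yes _   = refl
  ... | no  _   | no  v≢v = contradiction refl v≢v

  module _ (c : ℕ) where

    -- The carriers that receive colour c in both copies.
    Matched : Entry → Set
    Matched (edgeIn _ _ _ a) = a ≡ c
    Matched (rungAt _ d)     = d ≢ c

    matched? : ∀ e → Dec (Matched e)
    matched? (edgeIn _ _ _ a) = a ℕ.≟ c
    matched? (rungAt _ d)     = ¬? (d ℕ.≟ c)

    OppositeCopies : Entry → Entry → Set
    OppositeCopies e e′ = OppositeKinds (entryKind e) (entryKind e′) × entryColour e ≢ c × entryColour e′ ≢ c

    EntriesSeparated : Entry → Entry → Set
    EntriesSeparated e e′ = Apart (entryVertices e) (entryVertices e′) ⊎ OppositeCopies e e′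

    Separated : Carrier → Carrier → Set
    Separated s s′ = Apart (vertices s) (vertices s′) ⊎ OppositeCopies (erase s) (erase s′)

    separated-matched : ∀ {s s′} → Separated s s′ → Matched (erase s) ⊎ Matched (erase s′) →
                        Apart (vertices s) (vertices s′)
    separated-matched (inj₁ s#s′) _ = s#s′
    separated-matched {carrier (copy _) _ _ _} {carrier (copy _) _ _ _} (inj₂ (_ , a≢c , _)) (inj₁ a≡c) =
      contradiction a≡c a≢c
    separated-matched {carrier (copy _) _ _ _} {carrier (copy _) _ _ _} (inj₂ (_ , _ , a′≢c)) (inj₂ a′≡c) =
      contradiction a′≡c a′≢c
    separated-matched {carrier (copy _) _ _ _} {carrier rung _ _ _} (inj₂ (() , _)) _
    separated-matched {carrier rung _ _ _} (inj₂ (() , _)) _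

    partnerIn : Carrier → Fin n → Maybe (Fin n)
    partnerIn s@(carrier _ u v _) w with matched? (erase s)
    ... | yes _ = otherEnd u v w
    ... | no  _ = nothing

    matching : List Carrier → Fin n → Maybe (Fin n)
    matching []      _ = nothing
    matching (s ∷ A) w = partnerIn s w <∣> matching A w

    partnerIn-sound : ∀ s {w y} → partnerIn s w ≡ just y → Matched (erase s) × OnEdge s w y
    partnerIn-sound s@(carrier _ _ _ _) eq with matched? (erase s)
    ... | yes m = m , otherEnd-sound eq
    ... | no  _ = contradiction eq λ ()

    partnerIn-complete : ∀ {p} s {w y} → ValidCarrier p s → Matched (erase s) → OnEdge s w y →
                         partnerIn s w ≡ just y
    partnerIn-complete s@(carrier _ _ _ _) (uv , _) m on with matched? (erase s)
    ... | yes _  = otherEnd-complete (adjacent⇒≢ uv) on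
    ... | no  ¬m = contradiction m ¬m

    matching-sound : ∀ A {w y} → matching A w ≡ just y → ∃ λ s → s ∈ A × Matched (erase s) × OnEdge s w y
    matching-sound (s ∷ A) {w} eq with partnerIn s w in s-partner
    ... | just _  = s , here refl , partnerIn-sound s (trans s-partner eq)
    ... | nothing = let s′ , s′∈ , found = matching-sound A eq in s′ , there s′∈ , found

    matching-complete : ∀ {p A s w y} → AllPairs Separated A → All (ValidCarrier p) A → s ∈ A →
                        Matched (erase s) → OnEdge s w y → matching A w ≡ just y
    matching-complete {s = s} _ (s-valid ∷ _) (here refl) m on
      rewrite partnerIn-complete s s-valid m on = refl
    matching-complete {A = s₀ ∷ A} {s} {w} (s₀-sep ∷ sep) (_ ∷ valid) (there s∈) m on
      with partnerIn s₀ w in s₀-partner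
    ... | just _  = let m₀ , on₀ = partnerIn-sound s₀ s₀-partner in contradiction (OnEdge⇒∈ s on)
                    (Apart-∈ (separated-matched (All.lookup s₀-sep s∈) (inj₁ m₀)) (OnEdge⇒∈ s₀ on₀))
    ... | nothing = matching-complete sep valid s∈ m on

    matching-involutive : ∀ {p A w y} → AllPairs Separated A → All (ValidCarrier p) A →
                          matching A w ≡ just y → matching A y ≡ just w
    matching-involutive {A = A} sep valid eq =
      let s , s∈ , m , on = matching-sound A eq in matching-complete sep valid s∈ m (OnEdge-sym s on)

    matching-unmatched : ∀ {A s z y} → AllPairs Separated A → s ∈ A → ¬ Matched (erase s) → z ∈ vertices s →
                         matching A z ≢ just y
    matching-unmatched {A} sep s∈ ¬m z∈ eq with matching-sound A eq
    ... | s′ , s′∈ , m′ , on′ with AllPairs-∈ sep s∈ s′∈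
    ...   | inj₁ refl         = ¬m m′
    ...   | inj₂ (inj₁ s#s′)  = Apart-∈ (separated-matched s#s′ (inj₂ m′)) z∈ (OnEdge⇒∈ s′ on′)
    ...   | inj₂ (inj₂ s′#s)  = Apart-∈ (separated-matched s′#s (inj₁ m′)) (OnEdge⇒∈ s′ on′) z∈

    matching-adjacent : ∀ {p A w y} → All (ValidCarrier p) A → matching A w ≡ just y → T (G w y)
    matching-adjacent {A = A} valid eq =
      let s , s∈ , _ , on = matching-sound A eq in OnEdge-adjacent s (All.lookup valid s∈) on

    entries-separated : ∀ {p} (Allowed : Entry → Set) →
                        (∀ {e e′} → Allowed e → Allowed e′ → OppositeKinds (entryKind e) (entryKind e′) →
                                    entryColour e ≢ c × entryColour e′ ≢ c) →
                        ∀ {P} → All (PrecolouredEdgeIn (G □K₂) p) P → All (Allowed ∘ entry) P →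
                        AllPairs Disjoint P → AllPairs EntriesSeparated (map entry P)
    entries-separated {p} Allowed allowed⇒ valid allowed disjoint =
      AllPairs.map⁺ (AllPairs-zipAll separate (All.zip (valid , allowed)) disjoint)
      where
      separate : ∀ {e e′} → PrecolouredEdgeIn (G □K₂) p e × Allowed (entry e) →
                 PrecolouredEdgeIn (G □K₂) p e′ × Allowed (entry e′) →
                 Disjoint e e′ → EntriesSeparated (entry e) (entry e′)
      separate {e} {e′} (e-valid , e-allowed) (e′-valid , e′-allowed) e#e′
        with prismApart⇒apart⊎opposite (entry e) (entry e′)
               (disjoint⇒prismVertices-apart e e′ e-valid e′-valid e#e′)
      ... | inj₁ apart    = inj₁ apart
      ... | inj₂ opposite = inj₂ (opposite , allowed⇒ e-allowed e′-allowed opposite)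

    Avoids : Carrier → Entry → Set
    Avoids s e = Apart (partners s) (entryVertices e)

    Partner : List Entry → List Carrier → Entry → Fin n → Set
    Partner pre A (edgeIn _ _ _ _) _ = ⊤
    Partner pre A (rungAt w _)     x =
      T (G w x) × All (All (x ≢_) ∘ entryVertices) pre × All (All (x ≢_) ∘ vertices) A

    attach-valid : ∀ {p pre A x} e → ValidEntry p e → Partner pre A e x → ValidCarrier p (attach e x)
    attach-valid (edgeIn _ _ _ _) e-valid _          = e-valid
    attach-valid (rungAt _ _)     d∈      (wx , _ , _) = wx , d∈

    attach-avoids : ∀ {pre A x} e → Partner pre A e x → All (Avoids (attach e x)) pre
    attach-avoids (edgeIn _ _ _ _) _               = All.tabulate λ _ → []
    attach-avoids (rungAt _ _)     (_ , x∉pre , _) = All.map (_∷ []) x∉pre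

    attach-separated : ∀ {pre A x} e → Partner pre A e x → All (EntriesSeparated e ∘ erase) A →
                       All (λ s′ → Avoids s′ e) A → All (Separated (attach e x)) A
    attach-separated (edgeIn b u v a) _ seps avoids =
      All.zipWith (λ (e#s′ , s′-avoids) → copy-separated e#s′ s′-avoids) (seps , avoids)
      where
      copy-separated : ∀ {s′} → EntriesSeparated (edgeIn b u v a) (erase s′) → Avoids s′ (edgeIn b u v a) →
                       Separated (carrier (copy b) u v a) s′
      copy-separated {carrier (copy _) _ _ _} (inj₁ apart) _ = inj₁ apart
      copy-separated {carrier rung _ _ _} (inj₁ apart) s′-avoids = inj₁ (Apart-++ʳ apart (Apart-sym s′-avoids))
      copy-separated (inj₂ opposite) _ = inj₂ opposite
    attach-separated {x = x} (rungAt w d) (_ , _ , x∉A) seps avoids =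
      All.zipWith (λ ((e#s′ , s′-avoids) , x∉s′) → rung-separated e#s′ s′-avoids x∉s′)
                  (All.zip (seps , avoids) , x∉A)
      where
      rung-separated : ∀ {s′} → EntriesSeparated (rungAt w d) (erase s′) → Avoids s′ (rungAt w d) →
                       All (x ≢_) (vertices s′) → Separated (carrier rung w x d) s′
      rung-separated {carrier (copy _) _ _ _} (inj₁ (w∉s′ ∷ [])) _ x∉s′ = inj₁ (w∉s′ ∷ x∉s′ ∷ [])
      rung-separated {carrier rung _ _ _} (inj₁ ((w≢w′ ∷ []) ∷ [])) ((x′≢w ∷ []) ∷ []) x∉s′ =
        inj₁ ((w≢w′ ∷ ≢-sym x′≢w ∷ []) ∷ x∉s′ ∷ [])
      rung-separated (inj₂ (() , _)) _ _

    module ChooseCarriers (p k : ℕ) (k<degree : ∀ w → k < degree G w) where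

      record CarriersOf (pre L : List Entry) : Set where
        constructor carriersOf
        field
          carrierList : List Carrier
          erases      : map erase carrierList ≡ L
          separated   : AllPairs Separated carrierList
          avoid       : All (λ s → All (Avoids s) pre) carrierList
          valid       : All (ValidCarrier p) carrierList

      ∃-partner : ∀ pre A e → All (ValidEntry p) pre → All (ValidCarrier p) A → length pre + length A ≤ k →
                  ∃ (Partner pre A e)
      ∃-partner pre A (edgeIn _ u _ _) _ _ _ = u , tt
      ∃-partner pre A (rungAt w _) pre-valid A-valid |pre|+|A|≤k =
        let x , wx , x∉ = ∃-neighbour-avoiding w Bs cliques |Bs|<deg in
        x , wx , All.map⁻ (All.++⁻ˡ (map entryVertices pre) x∉)
             , All.map⁻ (All.++⁻ʳ (map entryVertices pre) x∉)
        where
        Bs : List (List (Fin n))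
        Bs = map entryVertices pre ++ map vertices A
        cliques : All Clique Bs
        cliques = All.++⁺ (All.map⁺ (All.map (entryVertices-clique _) pre-valid))
                          (All.map⁺ (All.map (vertices-clique _) A-valid))
        |Bs|<deg : length Bs < degree G w
        |Bs|<deg = begin-strict
          length Bs                       ≡⟨ List.length-++ (map entryVertices pre) ⟩
          length (map entryVertices pre) + length (map vertices A)
                                          ≡⟨ cong₂ _+_ (List.length-map entryVertices pre) (List.length-map vertices A) ⟩
          length pre + length A           ≤⟨ |pre|+|A|≤k ⟩
          k                               <⟨ k<degree w ⟩
          degree G w                      ∎
          where open ℕ.≤-Reasoning

      -- Partners are fixed from the back of the list, each avoiding every other entry.
      carriers : ∀ pre L → AllPairs EntriesSeparated L → All (ValidEntry p) L → All (ValidEntry p) pre →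
                 length pre + length L ≤ suc k → CarriersOf pre L
      carriers pre []      _ _ _ _ = carriersOf [] refl [] [] []
      carriers pre (e ∷ L) (e-sep ∷ L-sep) (e-valid ∷ L-valid) pre-valid len =
        carriersOf (attach e x ∷ A) (cong₂ _∷_ (erase-attach e) A↦L)
                   (attach-separated e partner (All.map⁻ (subst (All _) (sym A↦L) e-sep)) (All.map All.head A-avoid)
                    ∷ A-separated)
                   (attach-avoids e partner ∷ All.map All.tail A-avoid)
                   (attach-valid e e-valid partner ∷ A-valid)
        where
        |e∷pre|+|L|≤1+k : length (e ∷ pre) + length L ≤ suc k
        |e∷pre|+|L|≤1+k = subst (_≤ suc k) (ℕ.+-suc (length pre) (length L)) len
        open CarriersOf (carriers (e ∷ pre) L L-sep L-valid (e-valid ∷ pre-valid) |e∷pre|+|L|≤1+k)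
          renaming (carrierList to A; erases to A↦L; separated to A-separated; avoid to A-avoid; valid to A-valid)
        |pre|+|A|≤k : length pre + length A ≤ k
        |pre|+|A|≤k = subst (λ m → length pre + m ≤ k) (sym (length-erase A↦L)) (s≤s⁻¹ |e∷pre|+|L|≤1+k)
        x : Fin n
        x = proj₁ (∃-partner pre A e pre-valid A-valid |pre|+|A|≤k)
        partner : Partner pre A e x
        partner = proj₂ (∃-partner pre A e pre-valid A-valid |pre|+|A|≤k)

    -- The precolouring of G that the colouring of copy b must extend, with c removed from the palette.
    Selected : Bool → Entry → Set
    Selected b e = InLayer b (entryKind e) × entryColour e ≢ c

    selected? : ∀ b e → Dec (Selected b e)
    selected? b e = inLayer? b (entryKind e) ×-dec ¬? (entryColour e ℕ.≟ c)

    restrict : Carrier → PrecolouredEdge n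
    restrict (carrier _ u v a) = u , v , punchOut c a

    layer : Bool → List Carrier → List (PrecolouredEdge n)
    layer b A = map restrict (filter (selected? b ∘ erase) A)

    selected-disjoint : ∀ {b s s′} → Selected b (erase s) → Selected b (erase s′) → Separated s s′ →
                        Disjoint (restrict s) (restrict s′)
    selected-disjoint {s = carrier _ _ _ _} {carrier _ _ _ _} _ _ (inj₁ ((p ∷ q ∷ []) ∷ (r ∷ s ∷ []) ∷ [])) =
      p , q , r , s
    selected-disjoint (in-b , _) (in-b′ , _) (inj₂ (opposite , _)) =
      contradiction opposite (inLayer⇒¬opposite in-b in-b′)

    layer-independent : ∀ {t k} b A → InPalette (suc t) c → AllPairs Separated A →
                        All (ValidCarrier (suc t)) A → length (filter (selected? b ∘ erase) A) ≤ k →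
                        IsIndepPrecolouring G t k (layer b A)
    layer-independent {t} {k} b A c∈ sep valid len =
      All.map (λ { {_ , _ , _} v → v })
              (All.map⁺ (All.map restrict-valid (All.zip (All.filter⁺ _ valid , all-selected))))
      , AllPairs⇒lookup (AllPairs.map⁺ {f = restrict} (AllPairs-zipAll selected-disjoint all-selected (AllPairs.filter⁺ _ sep)))
                        (λ {e} {e′} → Disjoint-sym {n} {e} {e′})
      , subst (_≤ k) (sym (List.length-map restrict (filter (selected? b ∘ erase) A))) len
      where
      all-selected : All (Selected b ∘ erase) (filter (selected? b ∘ erase) A)
      all-selected = All.all-filter (selected? b ∘ erase) A
      restrict-valid : ∀ {s} → ValidCarrier (suc t) s × Selected b (erase s) → PrecolouredEdgeIn G t (restrict s)
      restrict-valid {carrier (copy _) _ _ _} ((uv , a∈) , _ , a≢c) = uv , punchOut-palette c∈ a∈ a≢c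
      restrict-valid {carrier rung _ _ _}     ((uv , a∈) , _ , a≢c) = uv , punchOut-palette c∈ a∈ a≢c

    layer-length : ∀ {k} b A → length A ≤ suc k → Any (¬_ ∘ Selected b ∘ erase) A →
                   length (filter (selected? b ∘ erase) A) ≤ k
    layer-length b A |A|≤1+k unselected =
      s≤s⁻¹ (ℕ.≤-trans (List.filter-notAll (selected? b ∘ erase) A unselected) |A|≤1+k)

    Extends : EdgeColouring n → Carrier → Set
    Extends φ s = ColouredBy φ (restrict s)

    ExtendsLayer : ℕ → Bool → List Carrier → EdgeColouring n → Set
    ExtendsLayer t b A φ = IsProperColouring G t φ × (∀ {s} → s ∈ A → Selected b (erase s) → Extends φ s)

    layer-extension : ∀ {t} b A → Extendable G t (layer b A) → ∃ (ExtendsLayer t b A)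
    layer-extension b A (φ , φ-proper , φ-agrees) =
      φ , φ-proper , λ s∈ selected → All.lookup (All.map (λ { {_ , _ , _} eq → eq }) φ-agrees)
                                       (∈-map⁺ restrict (∈-filter⁺ (selected? b ∘ erase) s∈ selected))

    module StackCarriers {t} (c∈ : InPalette (suc t) c) (A : List Carrier) (sep : AllPairs Separated A)
                         (valid : All (ValidCarrier (suc t)) A)
                         (φ : Bool → EdgeColouring n) (φ-proper : ∀ b → IsProperColouring G t (φ b))
                         (φ-extends : ∀ b {s} → s ∈ A → Selected b (erase s) → Extends (φ b) s)
                         (copies-agree : ∀ {b u v} → carrier (copy b) u v c ∈ A → φ true u v ≡ φ false u v) where

      endpoints-agree : ∀ {u v w y} → Endpoints u v w y → T (G u v) → φ true u v ≡ φ false u v →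
                        φ true w y ≡ φ false w y
      endpoints-agree (inj₁ (refl , refl)) _ agree = agree
      endpoints-agree {u} {v} (inj₂ (refl , refl)) uv agree =
        trans (sym (proj₁ (φ-proper true) u v uv)) (trans agree (proj₁ (φ-proper false) u v uv))

      matching-agree : ∀ {w y} → matching A w ≡ just y → φ true w y ≡ φ false w y
      matching-agree eq with matching-sound A eq
      ... | carrier (copy b) u v a , s∈ , refl , on =
        endpoints-agree on (proj₁ (All.lookup valid s∈)) (copies-agree s∈)
      ... | carrier rung w x d , s∈ , d≢c , on =
        endpoints-agree on (proj₁ (All.lookup valid s∈))
                        (trans (φ-extends true s∈ (tt , d≢c)) (sym (φ-extends false s∈ (tt , d≢c))))

      open StackColourings G t c c∈ φ φ-proper (matching A) (matching-adjacent valid)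
                           (matching-involutive sep valid) matching-agree

      copy-coloured : ∀ b {u v a} → carrier (copy b) u v a ∈ A → recolour (φ b) u v ≡ a
      copy-coloured b {u} {v} {a} s∈ with a ℕ.≟ c
      ... | yes refl = recolour-matched (φ b) (matching-complete sep valid s∈ refl (inj₁ (refl , refl)))
      ... | no  a≢c  = begin
        recolour (φ b) u v        ≡⟨ recolour-unmatched (φ b) (matching-unmatched sep s∈ a≢c (here refl)) ⟩
        punchIn c (φ b u v)       ≡⟨ cong (punchIn c) (φ-extends b s∈ (refl , a≢c)) ⟩
        punchIn c (punchOut c a)  ≡⟨ punchIn-punchOut a≢c ⟩
        a                         ∎
        where open ≡-Reasoning

      rung-coloured : ∀ {w x d} → carrier rung w x d ∈ A → rungColour w ≡ d
      rung-coloured {w} {x} {d} s∈ with d ℕ.≟ c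
      ... | yes refl = rungColour-unmatched
                         (≢just⇒≡nothing (matching-unmatched sep s∈ (λ d≢d → d≢d refl) (here refl)))
      ... | no  d≢c  = begin
        rungColour w              ≡⟨ rungColour-matched (matching-complete sep valid s∈ d≢c (inj₁ (refl , refl))) ⟩
        punchIn c (φ true w x)    ≡⟨ cong (punchIn c) (φ-extends true s∈ (tt , d≢c)) ⟩
        punchIn c (punchOut c d)  ≡⟨ punchIn-punchOut d≢c ⟩
        d                         ∎
        where open ≡-Reasoning

      prism-coloured : ∀ r q {s a} → s ∈ A → entryOf r q a ≡ erase s → prismColour r q ≡ a
      prism-coloured (inj₁ _) (inj₁ _) {carrier (copy _) _ _ _} s∈ refl = copy-coloured true s∈
      prism-coloured (inj₂ _) (inj₂ _) {carrier (copy _) _ _ _} s∈ refl = copy-coloured false s∈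
      prism-coloured (inj₁ _) (inj₂ _) {carrier rung _ _ _}     s∈ refl = rung-coloured s∈
      prism-coloured (inj₂ _) (inj₁ _) {carrier rung _ _ _}     s∈ refl = rung-coloured s∈
      prism-coloured (inj₁ _) (inj₁ _) {carrier rung _ _ _}     _  ()
      prism-coloured (inj₂ _) (inj₂ _) {carrier rung _ _ _}     _  ()
      prism-coloured (inj₁ _) (inj₂ _) {carrier (copy _) _ _ _} _  ()
      prism-coloured (inj₂ _) (inj₁ _) {carrier (copy _) _ _ _} _  ()

      stacked-extends : ∀ P → map erase A ≡ map entry P → Extendable (G □K₂) (suc t) P
      stacked-extends P A↦P =
        stacked , stacked-proper , All.map (λ { {_ , _ , _} eq → eq }) (All.tabulate coloured)
        where
        coloured : ∀ {e} → e ∈ P → ColouredBy stacked e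
        coloured {e@(x , y , a)} e∈ =
          let s , s∈ , e↦s = ∈-map⁻ erase (subst (entry e ∈_) (sym A↦P) (∈-map⁺ entry e∈)) in
          prism-coloured (splitAt n x) (splitAt n y) s∈ e↦s

  entryColour-palette : ∀ {p} e → ValidEntry p e → InPalette p (entryColour e)
  entryColour-palette (edgeIn _ _ _ _) (_ , a∈) = a∈
  entryColour-palette (rungAt _ _)     d∈       = d∈

  firstColour : List Entry → ℕ
  firstColour []      = 1
  firstColour (e ∷ _) = entryColour e

  firstColour-palette : ∀ {p L} → All (ValidEntry (suc p)) L → InPalette (suc p) (firstColour L)
  firstColour-palette []            = s≤s z≤n , s≤s z≤n
  firstColour-palette (e-valid ∷ _) = entryColour-palette _ e-valid

  firstColour-unselected : ∀ {k} b L → length L ≤ suc k →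
                           Any (¬_ ∘ Selected (firstColour L) b) L ⊎ length L ≤ k
  firstColour-unselected b []      _ = inj₂ z≤n
  firstColour-unselected b (e ∷ L) _ = inj₁ (here λ (_ , a≢a) → a≢a refl)

module Extension {n} {G : Graph n} (simple : IsSimple G) (triangleFree : TriangleFree G) (regular : Regular G)
                 (χ : ℕ) (isχ′ : IsChromaticIndex G χ) (k : ℕ) (k<Δ : k < maxDegree G)
                 (extendG : ∀ Q → IsIndepPrecolouring G χ k Q → Extendable G χ Q)
                 (P : List (PrecolouredEdge (n + n)))
                 (P-indep : IsIndepPrecolouring (G □K₂) (suc χ) (suc k) P) where

  open PrismPrecolourings simple triangleFree

  k<degree : ∀ w → k < degree G w
  k<degree w = ℕ.<-≤-trans k<Δ (regular⇒maxDegree≤degree regular w)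

  k<χ : Fin n → k < χ
  k<χ w = ℕ.<-≤-trans (k<degree w) (degree≤colours (proj₂ (proj₁ isχ′)) w)

  L : List Entry
  L = map entry P

  P-valid : All (PrecolouredEdgeIn (G □K₂) (suc χ)) P
  P-valid = All.map (λ { {_ , _ , _} valid → valid }) (proj₁ P-indep)

  L-valid : All (ValidEntry (suc χ)) L
  L-valid = All.map⁺ (All.map (entry-valid _) P-valid)

  |L|≤1+k : length L ≤ suc k
  |L|≤1+k = subst (_≤ suc k) (sym (List.length-map entry P)) (proj₂ (proj₂ P-indep))

  module AtColour (c : ℕ) (c∈ : InPalette (suc χ) c) (Allowed : Entry → Set) (allowed : All Allowed L)
                  (allowed⇒ : ∀ {e e′} → Allowed e → Allowed e′ → OppositeKinds (entryKind e) (entryKind e′) →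
                                          entryColour e ≢ c × entryColour e′ ≢ c) where

    open ChooseCarriers c (suc χ) k k<degree

    open CarriersOf (carriers [] L (entries-separated c Allowed allowed⇒ P-valid (All.map⁻ allowed)
                                                   (lookup⇒AllPairs P (proj₁ (proj₂ P-indep))))
                            L-valid [] |L|≤1+k)
      public renaming (carrierList to A; erases to A↦L; separated to A-separated; valid to A-valid)

    All-erase : ∀ {Q : Entry → Set} → All Q L → All (Q ∘ erase) A
    All-erase = All.map⁻ ∘ subst (All _) (sym A↦L)

    Any-erase : ∀ {Q : Entry → Set} → Any Q L → Any (Q ∘ erase) A
    Any-erase = Any.map⁻ ∘ subst (Any _) (sym A↦L)

    layer-colouring : ∀ b → Any (¬_ ∘ Selected c b) L ⊎ length L ≤ k → ∃ (ExtendsLayer c χ b A)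
    layer-colouring b small =
      layer-extension c b A (extendG (layer c b A) (layer-independent c b A c∈ A-separated A-valid (bound small)))
      where
      |A|≡|L| : length A ≡ length L
      |A|≡|L| = length-erase A↦L
      bound : Any (¬_ ∘ Selected c b) L ⊎ length L ≤ k → length (filter (selected? c b ∘ erase) A) ≤ k
      bound (inj₁ unselected) =
        layer-length c b A (subst (_≤ suc k) (sym |A|≡|L|) |L|≤1+k) (Any-erase unselected)
      bound (inj₂ |L|≤k) =
        ℕ.≤-trans (List.length-filter (selected? c b ∘ erase) A) (subst (_≤ k) (sym |A|≡|L|) |L|≤k)

    extension-from : (colouring : ∀ b → ∃ (ExtendsLayer c χ b A)) →
                     (∀ {b u v} → carrier (copy b) u v c ∈ A →
                                  proj₁ (colouring true) u v ≡ proj₁ (colouring false) u v) →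
                     Extendable (G □K₂) (suc χ) P
    extension-from colouring copies-agree =
      StackCarriers.stacked-extends c c∈ A A-separated A-valid (proj₁ ∘ colouring) (proj₁ ∘ proj₂ ∘ colouring)
                                    (proj₂ ∘ proj₂ ∘ colouring) copies-agree P A↦L

  bothCopies : Any (InCopy true ∘ entryKind) L → Any (InCopy false ∘ entryKind) L →
               Extendable (G □K₂) (suc χ) P
  bothCopies in-true in-false =
    extension-from colouring copies-agree
    where
    |colours|≤χ : length (map entryColour L) ≤ χ
    |colours|≤χ = begin
      length (map entryColour L)  ≡⟨ List.length-map entryColour L ⟩
      length L                    ≤⟨ |L|≤1+k ⟩
      suc k                       ≤⟨ k<χ (entryAnchor (proj₁ (Any.satisfied in-true))) ⟩
      χ                           ∎
      where open ℕ.≤-Reasoning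
    unused : ∃ λ c → InPalette (suc χ) c × c ∉ map entryColour L
    unused = ∃-unused-colour χ (map entryColour L) |colours|≤χ
    c : ℕ
    c = proj₁ unused
    off-c : All (λ e → entryColour e ≢ c) L
    off-c = All.map ≢-sym (All.¬Any⇒All¬ L (proj₂ (proj₂ unused) ∘ Any.map⁺))
    open AtColour c (proj₁ (proj₂ unused)) (λ e → entryColour e ≢ c) off-c (λ a≢c a′≢c _ → a≢c , a′≢c)
    other-copy : ∀ b → Any (¬_ ∘ Selected c b) L
    other-copy true  = Any.map (λ in-other selected → inCopy⇒¬inLayer in-other (proj₁ selected)) in-false
    other-copy false = Any.map (λ in-other selected → inCopy⇒¬inLayer in-other (proj₁ selected)) in-true
    colouring : ∀ b → ∃ (ExtendsLayer c χ b A)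
    colouring b = layer-colouring b (inj₁ (other-copy b))
    copies-agree : ∀ {b u v} → carrier (copy b) u v c ∈ A →
                   proj₁ (colouring true) u v ≡ proj₁ (colouring false) u v
    copies-agree s∈ = contradiction refl (All.lookup (All-erase off-c) s∈)

  oneCopy : ∀ b → ¬ Any (InCopy (not b) ∘ entryKind) L → Extendable (G □K₂) (suc χ) P
  oneCopy b none =
    let φ , φ-proper , φ-extends = layer-colouring b (firstColour-unselected b L |L|≤1+k) in
    extension-from (λ _ → φ , φ-proper , λ s∈ → φ-extends s∈ ∘ to-layer-b s∈) (λ _ → refl)
    where
    not-other : All (¬_ ∘ InCopy (not b) ∘ entryKind) L
    not-other = All.¬Any⇒All¬ L none
    open AtColour (firstColour L) (firstColour-palette L-valid) (¬_ ∘ InCopy (not b) ∘ entryKind) not-other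
                  (λ e-in e′-in opposite →
                     [ ⊥-elim ∘ e-in , ⊥-elim ∘ e′-in ]′ (opposite⇒inCopy (not b) opposite))
    to-layer-b : ∀ {b′ s} → s ∈ A → Selected (firstColour L) b′ (erase s) →
                 Selected (firstColour L) b (erase s)
    to-layer-b s∈ (in-layer , off-c) = ¬inCopy⇒inLayer (All.lookup (All-erase not-other) s∈) in-layer , off-c

  extension : Extendable (G □K₂) (suc χ) P
  extension with Any.any? (inCopy? true ∘ entryKind) L | Any.any? (inCopy? false ∘ entryKind) L
  ... | yes in-true | yes in-false = bothCopies in-true in-false
  ... | no  none    | _            = oneCopy false none
  ... | yes _       | no  none     = oneCopy true none

theorem3p1 : (n : ℕ) (G : Graph n) → IsSimple G → TriangleFree G → Regular G →
    (χ : ℕ) → IsChromaticIndex G χ →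
    (k : ℕ) → k < maxDegree G →
    ((P : List (PrecolouredEdge n)) → IsIndepPrecolouring G χ k P → Extendable G χ P) →
    (P : List (PrecolouredEdge (n Data.Nat.+ n))) →
    IsIndepPrecolouring (G □K₂) (suc χ) (suc k) P → Extendable (G □K₂) (suc χ) P
theorem3p1 n G simple triangleFree regular χ isχ′ k k<Δ extendG P P-indep =
  Extension.extension simple triangleFree regular χ isχ′ k k<Δ extendG P P-indep
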